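{- Let $G=(V,E)$ be a hypergraph with a vertex $v\in V$ and an edge $e\in E$. Then: (1) if $\{v\}\notin E$, $\Psi(G,x)=x\cdot\Psi(G_{ -v},x)+\Psi(G_{\div v},x)$, and if $\{v\}\in E$, $\Psi(G,x)=x\cdot\Psi(G_{ -v},x)$; (2) if no edge of $E$ other than (this occurrence of) $e$ is a subset of $e$, $\Psi(G,x)=\Psi(G_{ -e},x)-\Psi\bigl((G_{ -e})_{\div e},x\bigr)$, and otherwise $\Psi(G,x)=\Psi(G_{ -e},x)$; (3) $\Psi(G,x)=\sum_{\emptyset\neq B\subseteq e}-(-x)^{|B|}\cdot\Psi(G_{ -B},x)$; (4) $\Psi(G,x)=\Psi(G_{ -e},x)-\Psi(G_{/e},x)+x\cdot\Psi(G_{ -V(e)},x)$.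
   Context: A hypergraph $G=(V,E)$ consists of a finite vertex set $V$ and a finite multiset $E$ of non-empty subsets of $V$ (edges). A set $W\subseteq V$ is a vertex cover of $G$ if $f\cap W\neq\emptyset$ for all $f\in E$; the vertex cover polynomial is $\Psi(G,x)=\sum_{W\subseteq V,\ W\text{ vertex cover}}x^{|W|}$. For a set $S$ of vertices, $G_{ -S}$ is obtained by deleting the vertices of $S$ together with all edges containing at least one of them; $G_{ -v}=G_{ -\{v\}}$ and $G_{ -V(e)}$ deletes all vertices of $e$. For a set $S$ of vertices of a hypergraph $H$ containing no edge of $H$, $H_{\div S}$ ("hiding") is the hypergraph with vertex set $V(H)\setminus S$ and edge multiset $\{f\setminus S: f\in E(H)\}$; $G_{\div v}=G_{\div\{v\}}$. $G_{ -e}$ is obtained by removing the edge $e$ (one occurrence). $G_{/e}$ (contraction) is obtained by removing $e$ and identifying all vertices of $e$ into a single new vertex (replacing them in every other edge). -}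

module Defs where

open import Data.Nat using (ℕ; zero; suc)
open import Data.Bool using (Bool; true; false; _∧_; if_then_else_)
open import Data.Fin using (Fin)
open import Data.Fin.Subset using (Subset; _⊆_; _∩_; _∪_; _─_; ⁅_⁆; ∣_∣; inside; outside; Nonempty)
open import Data.Fin.Subset.Properties using (_⊆?_; nonempty?)
open import Data.Vec using (_∷_; [])
open import Data.Bool.ListAction using (all)
open import Data.List using (List; []; _∷_; map; filter; foldr; removeAt; length; lookup; _++_)
open import Data.List.Relation.Unary.All using (All)
open import Data.Product using (_×_)
open import Data.Bool using (not; _≟_)
open import Data.Integer using (ℤ; _+_; _*_; _^_; 0ℤ)
open import Relation.Nullary using (does; ¬_)

-- A hypergraph on the ambient vertex universe Fin n:
-- a vertex set V ⊆ Fin n and a list (multiset) of edges.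
record Hypergraph (n : ℕ) : Set where
  constructor hg
  field
    verts : Subset n
    edges : List (Subset n)
open Hypergraph public

WellFormed : ∀ {n} → Hypergraph n → Set
WellFormed G = All Nonempty (edges G) × All (λ f → f ⊆ verts G) (edges G)

sumℤ : List ℤ → ℤ
sumℤ = foldr _+_ 0ℤ

allSubsets : (n : ℕ) → List (Subset n)
allSubsets zero = [] ∷ []
allSubsets (suc n) = map (outside ∷_) (allSubsets n) ++ map (inside ∷_) (allSubsets n)

isVertexCover : ∀ {n} → Hypergraph n → Subset n → Bool
isVertexCover G W = does (W ⊆? verts G) ∧ all (λ f → does (nonempty? (f ∩ W))) (edges G)

Ψ : ∀ {n} → Hypergraph n → ℤ → ℤ
Ψ {n} G x = sumℤ (map (λ W → x ^ ∣ W ∣) (filter (λ W → isVertexCover G W ≟ true) (allSubsets n)))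

avoids : ∀ {n} → Subset n → Subset n → Bool
avoids S f = not (does (nonempty? (f ∩ S)))

delSet : ∀ {n} → Hypergraph n → Subset n → Hypergraph n
delSet G S = hg (verts G ─ S) (filter (λ f → avoids S f ≟ true) (edges G))

delV : ∀ {n} → Hypergraph n → Fin n → Hypergraph n
delV G v = delSet G ⁅ v ⁆

hideSet : ∀ {n} → Hypergraph n → Subset n → Hypergraph n
hideSet G S = hg (verts G ─ S) (map (λ f → f ─ S) (edges G))

hideV : ∀ {n} → Hypergraph n → Fin n → Hypergraph n
hideV G v = hideSet G ⁅ v ⁆

delEdge : ∀ {n} → (G : Hypergraph n) → Fin (length (edges G)) → Hypergraph n
delEdge G i = hg (verts G) (removeAt (edges G) i)

-- G_{/e}: remove the edge e and identify all vertices of e into a single vertex;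
-- the new vertex is represented by the vertex u (intended: u ∈ e).
contractVia : ∀ {n} → (G : Hypergraph n) → Fin (length (edges G)) → Fin n → Hypergraph n
contractVia G i u =
  hg ((verts G ─ e) ∪ ⁅ u ⁆)
     (map (λ f → if avoids e f then f else ((f ─ e) ∪ ⁅ u ⁆)) (removeAt (edges G) i))
  where
    e = lookup (edges G) i

nonemptySubsetsOf : ∀ {n} → Subset n → List (Subset n)
nonemptySubsetsOf {n} e =
  filter (λ B → (does (B ⊆? e) Data.Bool.∧ does (nonempty? B)) ≟ true) (allSubsets n)

-- Ψ(G, x) is the sum of x^|W| over the subsets W of the ambient vertex set that cover G, and each
-- identity compares cover conditions pointwise after splitting this sum.
-- (1) The covers containing v are the W ∪ {v} with W a cover of G − v; the covers avoiding v are
-- the covers of G ÷ v, and there are none when {v} is an edge.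
-- (2) The covers of G − e that meet e are the covers of G, those missing e are the covers of
-- (G − e) ÷ e; if another edge lies inside e, every cover of G − e meets e.
-- (3) x^|B| Ψ(G − B) sums over the covers containing B, so the right-hand side weighs each cover W
-- by Σ_{∅≠B⊆e∩W} −(−1)^|B| = [e ∩ W ≠ ∅] = 1.
-- (4) Splitting the covers of G / e at the merged vertex u gives Ψ(G / e) = x Ψ(G − V(e)) + Ψ((G − e) ÷ e),
-- which combines with (2).

module Submission where

open import Defs
open import Data.Nat using (ℕ; zero; suc) renaming (_+_ to _+ℕ_)
import Data.Nat.Properties as ℕP
open import Data.Fin using (Fin)
open import Data.Fin.Subset using (Subset; _∈_; _⊆_; ⊥; ⁅_⁆; ∣_∣; _∩_; _∪_; _─_)
open import Data.Fin.Subset.Properties using (_⊆?_; nonempty?; _∈?_; ∣⁅x⁆∣≡1)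
open import Data.Fin.Properties using (any?)
open import Data.List using (List; map; length; lookup; []; _∷_; filter; removeAt; _++_)
import Data.List.Properties as ListP
import Data.List.Relation.Unary.All as All
open import Data.List.Relation.Unary.Any using (here; there)
open import Data.List.Membership.Propositional using () renaming (_∈_ to _∈ₗ_; _∉_ to _∉ₗ_)
open import Data.List.Membership.Propositional.Properties using (∈-lookup)
open import Data.Vec using ([]; _∷_) renaming (lookup to vlookup)
open import Data.Vec.Properties using ([]=⇒lookup)
open import Data.Bool using (Bool; true; false; _∧_; _∨_; not; if_then_else_) renaming (_≟_ to _≟B_)
open import Data.Bool.Properties
open import Data.Bool.ListAction using (all; and)
open import Data.Integer using (ℤ; 0ℤ; 1ℤ; _+_; _-_; _*_; _^_; -_)
import Data.Integer.Properties as ℤP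
open import Data.Integer.Tactic.RingSolver using (solve-∀)
open import Data.Product using (_×_; _,_)
open import Data.Empty using (⊥-elim)
open import Function using (_∘_)
open import Relation.Nullary using (does; ¬_)
open import Relation.Nullary.Decidable using (dec-true; decidable-stable)
open import Relation.Unary using (Decidable)
open import Relation.Binary.PropositionalEquality
open import Algebra.Bundles using (CommutativeMonoid)
open import Algebra.Properties.CommutativeSemigroup ℤP.+-commutativeSemigroup
  using () renaming (interchange to +-interchange)
open import Algebra.Properties.CommutativeSemigroup (CommutativeMonoid.commutativeSemigroup ∨-commutativeMonoid)
  using () renaming (interchange to ∨-interchange)
open import Algebra.Properties.CommutativeSemigroup (CommutativeMonoid.commutativeSemigroup ∧-commutativeMonoid)
  using () renaming (interchange to ∧-interchange; x∙yz≈y∙xz to ∧-leftSwap; xy∙z≈xz∙y to ∧-rightSwap)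

-- Boolean reflection of subset predicates

-- Boolean counterparts of nonempty? and _⊆?_ that, unlike does of the library deciders,
-- reduce on b ∷ p, so that cover conditions can be computed coordinatewise.
nonemptyᵇ : ∀ {n} → Subset n → Bool
nonemptyᵇ []      = false
nonemptyᵇ (b ∷ p) = b ∨ nonemptyᵇ p

_meets_ : ∀ {n} → Subset n → Subset n → Bool
p meets q = nonemptyᵇ (p ∩ q)

_⊆ᵇ_ : ∀ {n} → Subset n → Subset n → Bool
[]      ⊆ᵇ []      = true
(a ∷ p) ⊆ᵇ (b ∷ q) = (not a ∨ b) ∧ (p ⊆ᵇ q)

covers : ∀ {n} → Hypergraph n → Subset n → Bool
covers G W = W ⊆ᵇ verts G ∧ all (_meets W) (edges G)

does-∈? : ∀ {n} (i : Fin n) (p : Subset n) → does (i ∈? p) ≡ vlookup p i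
does-∈? Fin.zero    (true  ∷ p) = refl
does-∈? Fin.zero    (false ∷ p) = refl
does-∈? (Fin.suc i) (b ∷ p)     = does-∈? i p

does-any? : ∀ {n} {P : Fin n → Set} (P? : Decidable P) (p : Subset n) →
            (∀ i → does (P? i) ≡ vlookup p i) → does (any? P?) ≡ nonemptyᵇ p
does-any? P? []      _ = refl
does-any? P? (b ∷ p) h = cong₂ _∨_ (h Fin.zero) (does-any? (P? ∘ Fin.suc) p (h ∘ Fin.suc))

does-nonempty? : ∀ {n} (p : Subset n) → does (nonempty? p) ≡ nonemptyᵇ p
does-nonempty? p = does-any? (_∈? p) p (λ i → does-∈? i p)

does-⊆? : ∀ {n} (p q : Subset n) → does (p ⊆? q) ≡ p ⊆ᵇ q
does-⊆? []          []          = refl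
does-⊆? (false ∷ p) (b ∷ q)     = does-⊆? p q
does-⊆? (true ∷ p)  (false ∷ q) = refl
does-⊆? (true ∷ p)  (true ∷ q)  = does-⊆? p q

avoids≡not-meets : ∀ {n} (S f : Subset n) → avoids S f ≡ not (f meets S)
avoids≡not-meets S f = cong not (does-nonempty? (f ∩ S))

avoids⇒disjoint : ∀ {n} (S f : Subset n) → avoids S f ≡ true → f meets S ≡ false
avoids⇒disjoint S f S-avoids-f =
  trans (sym (not-involutive (f meets S))) (cong not (trans (sym (avoids≡not-meets S f)) S-avoids-f))

all-cong : ∀ {A : Set} {P Q : A → Bool} → (∀ a → P a ≡ Q a) → ∀ xs → all P xs ≡ all Q xs
all-cong P≗Q xs = cong and (ListP.map-cong P≗Q xs)

isVertexCover≡covers : ∀ {n} (G : Hypergraph n) W → isVertexCover G W ≡ covers G W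
isVertexCover≡covers G W =
  cong₂ _∧_ (does-⊆? W (verts G)) (all-cong (λ f → does-nonempty? (f ∩ W)) (edges G))

meets-comm : ∀ {n} (p q : Subset n) → p meets q ≡ q meets p
meets-comm []      []      = refl
meets-comm (a ∷ p) (b ∷ q) = cong₂ _∨_ (∧-comm a b) (meets-comm p q)

meets-∪ʳ : ∀ {n} (f A B : Subset n) → f meets (A ∪ B) ≡ f meets A ∨ f meets B
meets-∪ʳ []      []      []      = refl
meets-∪ʳ (a ∷ f) (b ∷ A) (c ∷ B) =
  trans (cong₂ _∨_ (∧-distribˡ-∨ a b c) (meets-∪ʳ f A B)) (∨-interchange (a ∧ b) (a ∧ c) (f meets A) (f meets B))

meets-∪ˡ : ∀ {n} (A B W : Subset n) → (A ∪ B) meets W ≡ A meets W ∨ B meets W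
meets-∪ˡ A B W = trans (meets-comm (A ∪ B) W)
  (trans (meets-∪ʳ W A B) (cong₂ _∨_ (meets-comm W A) (meets-comm W B)))

meets-⁅⁆ : ∀ {n} (f : Subset n) (v : Fin n) → f meets ⁅ v ⁆ ≡ vlookup f v
meets-⁅⁆ (a ∷ f) Fin.zero    = trans (cong (a ∧ true ∨_) (meets-⊥ f)) (trans (∨-identityʳ _) (∧-identityʳ a))
  where
  meets-⊥ : ∀ {n} (f : Subset n) → f meets ⊥ ≡ false
  meets-⊥ []      = refl
  meets-⊥ (a ∷ f) = trans (cong (a ∧ false ∨_) (meets-⊥ f)) (trans (∨-identityʳ _) (∧-zeroʳ a))
meets-⁅⁆ (a ∷ f) (Fin.suc v) = trans (cong (a ∧ false ∨_) (meets-⁅⁆ f v)) (cong (_∨ vlookup f v) (∧-zeroʳ a))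

⁅⁆-meets : ∀ {n} (v : Fin n) (f : Subset n) → ⁅ v ⁆ meets f ≡ vlookup f v
⁅⁆-meets v f = trans (meets-comm ⁅ v ⁆ f) (meets-⁅⁆ f v)

meets-at : ∀ {n} (p q : Subset n) (u : Fin n) → vlookup p u ≡ true → vlookup q u ≡ true → p meets q ≡ true
meets-at (true ∷ p) (true ∷ q) Fin.zero    refl refl = refl
meets-at (a ∷ p)    (b ∷ q)    (Fin.suc u) p∋u  q∋u  =
  trans (cong (a ∧ b ∨_) (meets-at p q u p∋u q∋u)) (∨-zeroʳ (a ∧ b))

disjoint-lookup : ∀ {n} (p q : Subset n) (u : Fin n) → p meets q ≡ false → vlookup q u ≡ true → vlookup p u ≡ false
disjoint-lookup p q u p∩q≡∅ q∋u with vlookup p u in p∋u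
... | false = refl
... | true  with () ← trans (sym p∩q≡∅) (meets-at p q u p∋u q∋u)

─-meets : ∀ {n} (f W S : Subset n) → W meets S ≡ false → (f ─ S) meets W ≡ f meets W
─-meets []          []          []          _    = refl
─-meets (a ∷ f)     (true ∷ W)  (true ∷ S)  ()
─-meets (true ∷ f)  (true ∷ W)  (false ∷ S) _    = refl
─-meets (false ∷ f) (true ∷ W)  (false ∷ S) W∩S≡∅ = ─-meets f W S W∩S≡∅
─-meets (a ∷ f)     (false ∷ W) (s ∷ S)     W∩S≡∅ =
  cong₂ _∨_ (trans (∧-zeroʳ _) (sym (∧-zeroʳ a))) (─-meets f W S W∩S≡∅)

─-self-meets : ∀ {n} (A W : Subset n) → (A ─ A) meets W ≡ false
─-self-meets []          []      = refl
─-self-meets (true ∷ A)  (w ∷ W) = ─-self-meets A W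
─-self-meets (false ∷ A) (w ∷ W) = ─-self-meets A W

∪-⊆ᵇ : ∀ {n} (A B V : Subset n) → (A ∪ B) ⊆ᵇ V ≡ A ⊆ᵇ V ∧ B ⊆ᵇ V
∪-⊆ᵇ []      []      []      = refl
∪-⊆ᵇ (a ∷ A) (b ∷ B) (c ∷ V) = trans
  (cong₂ _∧_ (trans (cong (_∨ c) (not-∨ a b)) (∨-distribʳ-∧ c (not a) (not b))) (∪-⊆ᵇ A B V))
  (∧-interchange (not a ∨ c) (not b ∨ c) (A ⊆ᵇ V) (B ⊆ᵇ V))
  where
  not-∨ : ∀ a b → not (a ∨ b) ≡ not a ∧ not b
  not-∨ true  b = refl
  not-∨ false b = refl

⊆ᵇ-─ : ∀ {n} (W V S : Subset n) → W ⊆ᵇ (V ─ S) ≡ W ⊆ᵇ V ∧ not (W meets S)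
⊆ᵇ-─ []          []          []          = refl
⊆ᵇ-─ (false ∷ W) (v ∷ V)     (s ∷ S)     = ⊆ᵇ-─ W V S
⊆ᵇ-─ (true ∷ W)  (v ∷ V)     (true ∷ S)  = sym (∧-zeroʳ (v ∧ W ⊆ᵇ V))
⊆ᵇ-─ (true ∷ W)  (v ∷ V)     (false ∷ S) =
  trans (cong (v ∧_) (⊆ᵇ-─ W V S)) (sym (∧-assoc v (W ⊆ᵇ V) (not (W meets S))))

⊆ᵇ-∪-disjoint : ∀ {n} (W A B : Subset n) → W meets B ≡ false → W ⊆ᵇ (A ∪ B) ≡ W ⊆ᵇ A
⊆ᵇ-∪-disjoint []         []         []         _ = refl
⊆ᵇ-∪-disjoint (true ∷ W) (a ∷ A)    (true ∷ B) ()
⊆ᵇ-∪-disjoint (true ∷ W) (a ∷ A)    (false ∷ B) W∩B≡∅ =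
  cong₂ _∧_ (∨-identityʳ a) (⊆ᵇ-∪-disjoint W A B W∩B≡∅)
⊆ᵇ-∪-disjoint (false ∷ W) (a ∷ A)   (b ∷ B)    W∩B≡∅ = ⊆ᵇ-∪-disjoint W A B W∩B≡∅

⁅⁆-⊆ᵇ : ∀ {n} (v : Fin n) (V : Subset n) → ⁅ v ⁆ ⊆ᵇ V ≡ vlookup V v
⁅⁆-⊆ᵇ Fin.zero    (b ∷ V) = trans (cong (b ∧_) (⊥-⊆ᵇ V)) (∧-identityʳ b)
  where
  ⊥-⊆ᵇ : ∀ {n} (V : Subset n) → ⊥ ⊆ᵇ V ≡ true
  ⊥-⊆ᵇ []      = refl
  ⊥-⊆ᵇ (v ∷ V) = ⊥-⊆ᵇ V
⁅⁆-⊆ᵇ (Fin.suc v) (b ∷ V) = ⁅⁆-⊆ᵇ v V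

⊆ᵇ-trans : ∀ {n} (A B C : Subset n) → A ⊆ᵇ B ≡ true → B ⊆ᵇ C ≡ true → A ⊆ᵇ C ≡ true
⊆ᵇ-trans []          []          []          _   _   = refl
⊆ᵇ-trans (true ∷ A)  (true ∷ B)  (true ∷ C)  A⊆B B⊆C = ⊆ᵇ-trans A B C A⊆B B⊆C
⊆ᵇ-trans (false ∷ A) (true ∷ B)  (true ∷ C)  A⊆B B⊆C = ⊆ᵇ-trans A B C A⊆B B⊆C
⊆ᵇ-trans (false ∷ A) (false ∷ B) (c ∷ C)     A⊆B B⊆C = ⊆ᵇ-trans A B C A⊆B B⊆C
⊆ᵇ-trans (true ∷ A)  (false ∷ B) (c ∷ C)     ()  _
⊆ᵇ-trans (a ∷ A)     (true ∷ B)  (false ∷ C) _   ()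

⊆ᵇ-∩ : ∀ {n} (B e W : Subset n) → B ⊆ᵇ (e ∩ W) ≡ B ⊆ᵇ e ∧ B ⊆ᵇ W
⊆ᵇ-∩ []      []      []      = refl
⊆ᵇ-∩ (b ∷ B) (c ∷ e) (w ∷ W) = trans
  (cong₂ _∧_ (∨-distribˡ-∧ (not b) c w) (⊆ᵇ-∩ B e W))
  (∧-interchange (not b ∨ c) (not b ∨ w) (B ⊆ᵇ e) (B ⊆ᵇ W))

⊆ᵇ-meets : ∀ {n} (f e W : Subset n) → f ⊆ᵇ e ≡ true → f meets W ≡ true → e meets W ≡ true
⊆ᵇ-meets (true ∷ f)  (true ∷ e)  (true ∷ W)  _   _   = refl
⊆ᵇ-meets (true ∷ f)  (true ∷ e)  (false ∷ W) f⊆e f∩W = ⊆ᵇ-meets f e W f⊆e f∩W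
⊆ᵇ-meets (false ∷ f) (c ∷ e)     (w ∷ W)     f⊆e f∩W =
  trans (cong (c ∧ w ∨_) (⊆ᵇ-meets f e W f⊆e f∩W)) (∨-zeroʳ (c ∧ w))
⊆ᵇ-meets (true ∷ f)  (false ∷ e) (w ∷ W)     ()  _
⊆ᵇ-meets []          []          []          _   ()

∪⁅⁆-∋ : ∀ {n} (A : Subset n) (u : Fin n) → vlookup (A ∪ ⁅ u ⁆) u ≡ true
∪⁅⁆-∋ (a ∷ A) Fin.zero    = ∨-zeroʳ a
∪⁅⁆-∋ (a ∷ A) (Fin.suc u) = ∪⁅⁆-∋ A u

∣∪∣-disjoint : ∀ {n} (W B : Subset n) → W meets B ≡ false → ∣ W ∪ B ∣ ≡ ∣ W ∣ +ℕ ∣ B ∣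
∣∪∣-disjoint []          []          _     = refl
∣∪∣-disjoint (true ∷ W)  (true ∷ B)  ()
∣∪∣-disjoint (true ∷ W)  (false ∷ B) W∩B≡∅ = cong suc (∣∪∣-disjoint W B W∩B≡∅)
∣∪∣-disjoint (false ∷ W) (true ∷ B)  W∩B≡∅ =
  trans (cong suc (∣∪∣-disjoint W B W∩B≡∅)) (sym (ℕP.+-suc ∣ W ∣ ∣ B ∣))
∣∪∣-disjoint (false ∷ W) (false ∷ B) W∩B≡∅ = ∣∪∣-disjoint W B W∩B≡∅

∧-elimˡ : ∀ a b → a ∧ b ≡ true → a ≡ true
∧-elimˡ true b _ = refl

∧-elimʳ : ∀ a b → a ∧ b ≡ true → b ≡ true
∧-elimʳ true b b≡true = b≡true

all-map : ∀ {A B : Set} (P : B → Bool) (g : A → B) xs → all P (map g xs) ≡ all (P ∘ g) xs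
all-map P g xs = cong and (sym (ListP.map-∘ xs))

all-filter : ∀ {A : Set} (P Q : A → Bool) xs →
             all P (filter (λ a → Q a ≟B true) xs) ≡ all (λ a → not (Q a) ∨ P a) xs
all-filter P Q []       = refl
all-filter P Q (x ∷ xs) with Q x
... | true  = cong (P x ∧_) (all-filter P Q xs)
... | false = all-filter P Q xs

all-removeAt : ∀ {A : Set} (P : A → Bool) xs (i : Fin (length xs)) →
               all P xs ≡ P (lookup xs i) ∧ all P (removeAt xs i)
all-removeAt P (x ∷ xs) Fin.zero    = refl
all-removeAt P (x ∷ xs) (Fin.suc i) =
  trans (cong (P x ∧_) (all-removeAt P xs i)) (∧-leftSwap (P x) (P (lookup xs i)) (all P (removeAt xs i)))

all-lookup : ∀ {A : Set} (P : A → Bool) xs → all P xs ≡ true → (j : Fin (length xs)) → P (lookup xs j) ≡ true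
all-lookup P (x ∷ xs) Pxs Fin.zero    = ∧-elimˡ (P x) _ Pxs
all-lookup P (x ∷ xs) Pxs (Fin.suc j) = all-lookup P xs (∧-elimʳ (P x) _ Pxs) j

all-removeAt-lookup : ∀ {A : Set} (P : A → Bool) xs (i j : Fin (length xs)) →
                      all P (removeAt xs i) ≡ true → j ≢ i → P (lookup xs j) ≡ true
all-removeAt-lookup P (x ∷ xs) Fin.zero    Fin.zero    _   j≢i = ⊥-elim (j≢i refl)
all-removeAt-lookup P (x ∷ xs) Fin.zero    (Fin.suc j) Pxs _   = all-lookup P xs Pxs j
all-removeAt-lookup P (x ∷ xs) (Fin.suc i) Fin.zero    Pxs _   = ∧-elimˡ (P x) _ Pxs
all-removeAt-lookup P (x ∷ xs) (Fin.suc i) (Fin.suc j) Pxs j≢i =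
  all-removeAt-lookup P xs i j (∧-elimʳ (P x) _ Pxs) (j≢i ∘ cong Fin.suc)

all-false : ∀ {A : Set} (P : A → Bool) {y} xs → y ∈ₗ xs → P y ≡ false → all P xs ≡ false
all-false P (x ∷ xs) (here refl) Py = cong (_∧ all P xs) Py
all-false P (x ∷ xs) (there y∈xs) Py = trans (cong (P x ∧_) (all-false P xs y∈xs Py)) (∧-zeroʳ (P x))

-- Sums over subsets

sumOver : ∀ {A : Set} → List A → (A → ℤ) → ℤ
sumOver xs f = sumℤ (map f xs)

infixr 8 [_]*_
[_]*_ : Bool → ℤ → ℤ
[ b ]* t = if b then t else 0ℤ

*-[]* : ∀ a c b → a * [ c ]* b ≡ [ c ]* (a * b)
*-[]* a true  b = refl
*-[]* a false b = ℤP.*-zeroʳ a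

[]*-∧ : ∀ a b t → [ a ]* [ b ]* t ≡ [ a ∧ b ]* t
[]*-∧ true  b t = refl
[]*-∧ false b t = refl

[]*-neg : ∀ c a → [ c ]* (- a) ≡ - [ c ]* a
[]*-neg true  a = refl
[]*-neg false a = refl

[]*-congᵗ : ∀ b {s t} → (b ≡ true → s ≡ t) → [ b ]* s ≡ [ b ]* t
[]*-congᵗ true  s≡t = s≡t refl
[]*-congᵗ false _   = refl

module _ {A : Set} where

  sumOver-cong : ∀ (xs : List A) {f g : A → ℤ} → (∀ a → f a ≡ g a) → sumOver xs f ≡ sumOver xs g
  sumOver-cong xs f≗g = cong sumℤ (ListP.map-cong f≗g xs)

  sumOver-+ : ∀ (xs : List A) (f g : A → ℤ) → sumOver xs (λ a → f a + g a) ≡ sumOver xs f + sumOver xs g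
  sumOver-+ []       f g = refl
  sumOver-+ (x ∷ xs) f g = trans (cong (f x + g x +_) (sumOver-+ xs f g))
                                 (+-interchange (f x) (g x) (sumOver xs f) (sumOver xs g))

  sumOver-* : ∀ (xs : List A) (c : ℤ) (f : A → ℤ) → sumOver xs (λ a → c * f a) ≡ c * sumOver xs f
  sumOver-* []       c f = sym (ℤP.*-zeroʳ c)
  sumOver-* (x ∷ xs) c f =
    trans (cong (c * f x +_) (sumOver-* xs c f)) (sym (ℤP.*-distribˡ-+ c (f x) (sumOver xs f)))

  sumOver-neg : ∀ (xs : List A) (f : A → ℤ) → sumOver xs (λ a → - f a) ≡ - sumOver xs f
  sumOver-neg []       f = refl
  sumOver-neg (x ∷ xs) f =
    trans (cong (- f x +_) (sumOver-neg xs f)) (sym (ℤP.neg-distrib-+ (f x) (sumOver xs f)))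

  sumOver-0 : ∀ (xs : List A) → sumOver xs (λ _ → 0ℤ) ≡ 0ℤ
  sumOver-0 []       = refl
  sumOver-0 (x ∷ xs) = trans (ℤP.+-identityˡ _) (sumOver-0 xs)

  sumOver-++ : ∀ (xs ys : List A) (f : A → ℤ) → sumOver (xs ++ ys) f ≡ sumOver xs f + sumOver ys f
  sumOver-++ []       ys f = sym (ℤP.+-identityˡ _)
  sumOver-++ (x ∷ xs) ys f =
    trans (cong (f x +_) (sumOver-++ xs ys f)) (sym (ℤP.+-assoc (f x) (sumOver xs f) (sumOver ys f)))

  sumOver-map : ∀ {B : Set} (xs : List A) (g : A → B) (f : B → ℤ) → sumOver (map g xs) f ≡ sumOver xs (f ∘ g)
  sumOver-map xs g f = cong sumℤ (sym (ListP.map-∘ xs))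

  sumOver-filter : ∀ (xs : List A) (p : A → Bool) (f : A → ℤ) →
                   sumOver (filter (λ a → p a ≟B true) xs) f ≡ sumOver xs (λ a → [ p a ]* f a)
  sumOver-filter []       p f = refl
  sumOver-filter (x ∷ xs) p f with p x
  ... | true  = cong (f x +_) (sumOver-filter xs p f)
  ... | false = trans (sumOver-filter xs p f) (sym (ℤP.+-identityˡ _))

sumOver-swap : ∀ {A B : Set} (xs : List A) (ys : List B) (f : A → B → ℤ) →
               sumOver xs (λ a → sumOver ys (f a)) ≡ sumOver ys (λ b → sumOver xs (λ a → f a b))
sumOver-swap []       ys f = sym (sumOver-0 ys)
sumOver-swap (x ∷ xs) ys f = trans (cong (sumOver ys (f x) +_) (sumOver-swap xs ys f))
                                   (sym (sumOver-+ ys (f x) (λ b → sumOver xs (λ a → f a b))))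

∑ₛ : ∀ n → (Subset n → ℤ) → ℤ
∑ₛ n = sumOver (allSubsets n)

∑ₛ-suc : ∀ n (f : Subset (suc n) → ℤ) →
         ∑ₛ (suc n) f ≡ ∑ₛ n (λ W → f (false ∷ W)) + ∑ₛ n (λ W → f (true ∷ W))
∑ₛ-suc n f = trans (sumOver-++ (map (false ∷_) (allSubsets n)) (map (true ∷_) (allSubsets n)) f)
                   (cong₂ _+_ (sumOver-map (allSubsets n) (false ∷_) f) (sumOver-map (allSubsets n) (true ∷_) f))

+-∑ₛ0 : ∀ n a → a + ∑ₛ n (λ _ → 0ℤ) ≡ a
+-∑ₛ0 n a = trans (cong (a +_) (sumOver-0 (allSubsets n))) (ℤP.+-identityʳ a)

∑ₛ0-+ : ∀ n a → ∑ₛ n (λ _ → 0ℤ) + a ≡ a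
∑ₛ0-+ n a = trans (cong (_+ a) (sumOver-0 (allSubsets n))) (ℤP.+-identityˡ a)

[]*-∑ₛ : ∀ n c (g : Subset n → ℤ) → ∑ₛ n (λ W → [ c ]* g W) ≡ [ c ]* ∑ₛ n g
[]*-∑ₛ n true  g = refl
[]*-∑ₛ n false g = sumOver-0 (allSubsets n)

∑ₛ-split : ∀ n (c : Subset n → Bool) (f : Subset n → ℤ) →
           ∑ₛ n f ≡ ∑ₛ n (λ W → [ c W ]* f W) + ∑ₛ n (λ W → [ not (c W) ]* f W)
∑ₛ-split n c f = trans (sumOver-cong (allSubsets n) (λ W → split (c W) (f W))) (sumOver-+ (allSubsets n) _ _)
  where
  split : ∀ b t → t ≡ [ b ]* t + [ not b ]* t
  split true  t = sym (ℤP.+-identityʳ t)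
  split false t = sym (ℤP.+-identityˡ t)

-- W ↦ W ∪ B is a bijection from the sets disjoint from B onto the supersets of B.
∑ₛ-translate : ∀ n (B : Subset n) (g : Subset n → ℤ) →
               ∑ₛ n (λ W → [ not (W meets B) ]* g (W ∪ B)) ≡ ∑ₛ n (λ W → [ B ⊆ᵇ W ]* g W)
∑ₛ-translate zero    []          g = refl
∑ₛ-translate (suc n) (false ∷ B) g = begin
  ∑ₛ (suc n) (λ W → [ not (W meets (false ∷ B)) ]* g (W ∪ (false ∷ B)))
    ≡⟨ ∑ₛ-suc n _ ⟩
  ∑ₛ n (λ W → [ not (W meets B) ]* g (false ∷ W ∪ B)) + ∑ₛ n (λ W → [ not (W meets B) ]* g (true ∷ W ∪ B))
    ≡⟨ cong₂ _+_ (∑ₛ-translate n B (g ∘ (false ∷_))) (∑ₛ-translate n B (g ∘ (true ∷_))) ⟩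
  ∑ₛ n (λ W → [ B ⊆ᵇ W ]* g (false ∷ W)) + ∑ₛ n (λ W → [ B ⊆ᵇ W ]* g (true ∷ W))
    ≡⟨ ∑ₛ-suc n _ ⟨
  ∑ₛ (suc n) (λ W → [ (false ∷ B) ⊆ᵇ W ]* g W) ∎
  where open ≡-Reasoning
∑ₛ-translate (suc n) (true ∷ B) g = begin
  ∑ₛ (suc n) (λ W → [ not (W meets (true ∷ B)) ]* g (W ∪ (true ∷ B)))
    ≡⟨ ∑ₛ-suc n _ ⟩
  ∑ₛ n (λ W → [ not (W meets B) ]* g (true ∷ W ∪ B)) + ∑ₛ n (λ _ → 0ℤ)
    ≡⟨ +-∑ₛ0 n _ ⟩
  ∑ₛ n (λ W → [ not (W meets B) ]* g (true ∷ W ∪ B))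
    ≡⟨ ∑ₛ-translate n B (g ∘ (true ∷_)) ⟩
  ∑ₛ n (λ W → [ B ⊆ᵇ W ]* g (true ∷ W))
    ≡⟨ ∑ₛ0-+ n _ ⟨
  ∑ₛ n (λ _ → 0ℤ) + ∑ₛ n (λ W → [ B ⊆ᵇ W ]* g (true ∷ W))
    ≡⟨ ∑ₛ-suc n _ ⟨
  ∑ₛ (suc n) (λ W → [ (true ∷ B) ⊆ᵇ W ]* g W) ∎
  where open ≡-Reasoning

∑ₛ-split-at : ∀ n (v : Fin n) (f : Subset n → ℤ) →
              ∑ₛ n f ≡ ∑ₛ n (λ W → [ not (W meets ⁅ v ⁆) ]* f (W ∪ ⁅ v ⁆))
                     + ∑ₛ n (λ W → [ not (W meets ⁅ v ⁆) ]* f W)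
∑ₛ-split-at n v f = trans (∑ₛ-split n (⁅ v ⁆ ⊆ᵇ_) f) (cong₂ _+_ (sym (∑ₛ-translate n ⁅ v ⁆ f))
  (sumOver-cong (allSubsets n) (λ W → cong (λ b → [ not b ]* f W) (trans (⁅⁆-⊆ᵇ v W) (sym (meets-⁅⁆ W v))))))

sign : ℕ → ℤ
sign zero    = 1ℤ
sign (suc k) = - sign k

-x^≡sign*x^ : ∀ (x : ℤ) k → (- x) ^ k ≡ sign k * x ^ k
-x^≡sign*x^ x zero    = refl
-x^≡sign*x^ x (suc k) = trans (cong ((- x) *_) (-x^≡sign*x^ x k)) (swap-neg x (sign k) (x ^ k))
  where
  swap-neg : ∀ a s p → (- a) * (s * p) ≡ (- s) * (a * p)
  swap-neg = solve-∀

∑ₛ-sign : ∀ n (T : Subset n) → ∑ₛ n (λ B → [ B ⊆ᵇ T ]* sign ∣ B ∣) ≡ [ not (nonemptyᵇ T) ]* 1ℤ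
∑ₛ-sign zero    []          = refl
∑ₛ-sign (suc n) (true ∷ T)  = trans (∑ₛ-suc n _) (trans (cong (⊆T +_) oddTerms) (ℤP.+-inverseʳ ⊆T))
  where
  ⊆T : ℤ
  ⊆T = ∑ₛ n (λ B → [ B ⊆ᵇ T ]* sign ∣ B ∣)
  oddTerms : ∑ₛ n (λ B → [ B ⊆ᵇ T ]* (- sign ∣ B ∣)) ≡ - ⊆T
  oddTerms = trans (sumOver-cong (allSubsets n) (λ B → []*-neg (B ⊆ᵇ T) (sign ∣ B ∣))) (sumOver-neg (allSubsets n) _)
∑ₛ-sign (suc n) (false ∷ T) = trans (∑ₛ-suc n _) (trans (+-∑ₛ0 n _) (∑ₛ-sign n T))

∑ₛ-sign-nonempty : ∀ n (T : Subset n) →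
                   ∑ₛ n (λ B → [ B ⊆ᵇ T ∧ nonemptyᵇ B ]* (- sign ∣ B ∣)) ≡ [ nonemptyᵇ T ]* 1ℤ
∑ₛ-sign-nonempty zero    []          = refl
∑ₛ-sign-nonempty (suc n) (true ∷ T)  = trans (∑ₛ-suc n _)
  (trans (cong₂ _+_ (∑ₛ-sign-nonempty n T) (trans (sumOver-cong (allSubsets n) withHead) (∑ₛ-sign n T)))
         (excludedMiddle (nonemptyᵇ T)))
  where
  withHead : ∀ B → [ B ⊆ᵇ T ∧ true ]* (- - sign ∣ B ∣) ≡ [ B ⊆ᵇ T ]* sign ∣ B ∣
  withHead B = cong₂ [_]*_ (∧-identityʳ (B ⊆ᵇ T)) (ℤP.neg-involutive (sign ∣ B ∣))
  excludedMiddle : ∀ b → [ b ]* 1ℤ + [ not b ]* 1ℤ ≡ 1ℤ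
  excludedMiddle true  = refl
  excludedMiddle false = refl
∑ₛ-sign-nonempty (suc n) (false ∷ T) = trans (∑ₛ-suc n _) (trans (+-∑ₛ0 n _) (∑ₛ-sign-nonempty n T))

-- Vertex covers of derived hypergraphs

coverWeight : ∀ {n} → Hypergraph n → ℤ → Subset n → ℤ
coverWeight G x W = [ covers G W ]* (x ^ ∣ W ∣)

Ψ≡∑coverWeight : ∀ {n} (G : Hypergraph n) (x : ℤ) → Ψ G x ≡ ∑ₛ n (coverWeight G x)
Ψ≡∑coverWeight {n} G x = trans (sumOver-filter (allSubsets n) (isVertexCover G) (λ W → x ^ ∣ W ∣))
  (sumOver-cong (allSubsets n) (λ W → cong (λ b → [ b ]* (x ^ ∣ W ∣)) (isVertexCover≡covers G W)))

module _ {n} (G : Hypergraph n) (W : Subset n) where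

  ⊆ᵇ-verts-─ : (S : Subset n) → W meets S ≡ true → W ⊆ᵇ (verts G ─ S) ≡ false
  ⊆ᵇ-verts-─ S W∩S = trans (⊆ᵇ-─ W (verts G) S) (trans (cong (λ b → W ⊆ᵇ verts G ∧ not b) W∩S) (∧-zeroʳ _))

  ⊆ᵇ-verts-─-disjoint : (S : Subset n) → W meets S ≡ false → W ⊆ᵇ (verts G ─ S) ≡ W ⊆ᵇ verts G
  ⊆ᵇ-verts-─-disjoint S W∩S≡∅ =
    trans (⊆ᵇ-─ W (verts G) S) (trans (cong (λ b → W ⊆ᵇ verts G ∧ not b) W∩S≡∅) (∧-identityʳ _))

  covers-delSet-meets : (S : Subset n) → W meets S ≡ true → covers (delSet G S) W ≡ false
  covers-delSet-meets S W∩S = cong (_∧ all (_meets W) (edges (delSet G S))) (⊆ᵇ-verts-─ S W∩S)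

  covers-hideSet-meets : (S : Subset n) → W meets S ≡ true → covers (hideSet G S) W ≡ false
  covers-hideSet-meets S W∩S = cong (_∧ all (_meets W) (edges (hideSet G S))) (⊆ᵇ-verts-─ S W∩S)

  covers-hideSet-disjoint : (S : Subset n) → W meets S ≡ false → covers (hideSet G S) W ≡ covers G W
  covers-hideSet-disjoint S W∩S≡∅ = cong₂ _∧_ (⊆ᵇ-verts-─-disjoint S W∩S≡∅)
    (trans (all-map (_meets W) (_─ S) (edges G)) (all-cong (λ f → ─-meets f W S W∩S≡∅) (edges G)))

  covers-delSet-disjoint : (B : Subset n) → B ⊆ᵇ verts G ≡ true → W meets B ≡ false →
                           covers (delSet G B) W ≡ covers G (W ∪ B)
  covers-delSet-disjoint B B⊆V W∩B≡∅ = cong₂ _∧_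
    (trans (⊆ᵇ-verts-─-disjoint B W∩B≡∅)
           (sym (trans (∪-⊆ᵇ W B (verts G)) (trans (cong (W ⊆ᵇ verts G ∧_) B⊆V) (∧-identityʳ _)))))
    (trans (all-filter (_meets W) (avoids B) (edges G)) (all-cong edge (edges G)))
    where
    edge : ∀ f → not (avoids B f) ∨ f meets W ≡ f meets (W ∪ B)
    edge f = trans (cong (λ b → not b ∨ f meets W) (avoids≡not-meets B f))
      (trans (cong (_∨ f meets W) (not-involutive (f meets B)))
      (trans (∨-comm (f meets B) (f meets W)) (sym (meets-∪ʳ f W B))))

  covers-delEdge : (i : Fin (length (edges G))) →
                   covers G W ≡ lookup (edges G) i meets W ∧ covers (delEdge G i) W
  covers-delEdge i = trans (cong (W ⊆ᵇ verts G ∧_) (all-removeAt (_meets W) (edges G) i))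
                           (∧-leftSwap (W ⊆ᵇ verts G) (lookup (edges G) i meets W) (all (_meets W) (removeAt (edges G) i)))

Ψ-hideSet≡∑avoiding : ∀ {n} (G : Hypergraph n) (S : Subset n) (x : ℤ) →
            Ψ (hideSet G S) x ≡ ∑ₛ n (λ W → [ not (W meets S) ]* coverWeight G x W)
Ψ-hideSet≡∑avoiding {n} G S x = trans (Ψ≡∑coverWeight (hideSet G S) x) (sumOver-cong (allSubsets n) weight)
  where
  weight : ∀ W → coverWeight (hideSet G S) x W ≡ [ not (W meets S) ]* coverWeight G x W
  weight W with W meets S in W∩S
  ... | true  = cong (λ b → [ b ]* (x ^ ∣ W ∣)) (covers-hideSet-meets G W S W∩S)
  ... | false = cong (λ b → [ b ]* (x ^ ∣ W ∣)) (covers-hideSet-disjoint G W S W∩S)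

Ψ-delSet≡∑containing : ∀ {n} (G : Hypergraph n) (B : Subset n) → B ⊆ᵇ verts G ≡ true → (x : ℤ) →
           x ^ ∣ B ∣ * Ψ (delSet G B) x ≡ ∑ₛ n (λ W → [ B ⊆ᵇ W ]* coverWeight G x W)
Ψ-delSet≡∑containing {n} G B B⊆V x = begin
  x ^ ∣ B ∣ * Ψ (delSet G B) x
    ≡⟨ cong (x ^ ∣ B ∣ *_) (Ψ≡∑coverWeight (delSet G B) x) ⟩
  x ^ ∣ B ∣ * ∑ₛ n (coverWeight (delSet G B) x)
    ≡⟨ sumOver-* (allSubsets n) (x ^ ∣ B ∣) _ ⟨
  ∑ₛ n (λ W → x ^ ∣ B ∣ * coverWeight (delSet G B) x W)
    ≡⟨ sumOver-cong (allSubsets n) weight ⟩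
  ∑ₛ n (λ W → [ not (W meets B) ]* coverWeight G x (W ∪ B))
    ≡⟨ ∑ₛ-translate n B (coverWeight G x) ⟩
  ∑ₛ n (λ W → [ B ⊆ᵇ W ]* coverWeight G x W) ∎
  where
  open ≡-Reasoning
  weight : ∀ W → x ^ ∣ B ∣ * coverWeight (delSet G B) x W ≡ [ not (W meets B) ]* coverWeight G x (W ∪ B)
  weight W with W meets B in W∩B
  ... | true  = trans (cong (λ b → x ^ ∣ B ∣ * [ b ]* (x ^ ∣ W ∣)) (covers-delSet-meets G W B W∩B))
                      (ℤP.*-zeroʳ (x ^ ∣ B ∣))
  ... | false = begin
    x ^ ∣ B ∣ * [ covers (delSet G B) W ]* (x ^ ∣ W ∣)
      ≡⟨ *-[]* (x ^ ∣ B ∣) _ (x ^ ∣ W ∣) ⟩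
    [ covers (delSet G B) W ]* (x ^ ∣ B ∣ * x ^ ∣ W ∣)
      ≡⟨ cong₂ [_]*_ (covers-delSet-disjoint G W B B⊆V W∩B) (ℤP.*-comm (x ^ ∣ B ∣) (x ^ ∣ W ∣)) ⟩
    [ covers G (W ∪ B) ]* (x ^ ∣ W ∣ * x ^ ∣ B ∣)
      ≡⟨ cong (λ k → [ covers G (W ∪ B) ]* k)
              (trans (sym (ℤP.^-distribˡ-+-* x ∣ W ∣ ∣ B ∣)) (cong (x ^_) (sym (∣∪∣-disjoint W B W∩B)))) ⟩
    coverWeight G x (W ∪ B) ∎

module Contraction {n} (G : Hypergraph n) (i : Fin (length (edges G))) (u : Fin n)
                   (u∈e′ : u ∈ lookup (edges G) i) where

  private
    e : Subset n
    e = lookup (edges G) i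
    u∈e : vlookup e u ≡ true
    u∈e = []=⇒lookup u∈e′
    E′ : List (Subset n)
    E′ = removeAt (edges G) i
    C : Hypergraph n
    C = contractVia G i u
    H : Hypergraph n
    H = hideSet (delEdge G i) e
    merge : Subset n → Subset n
    merge f = if avoids e f then f else ((f ─ e) ∪ ⁅ u ⁆)
    ∋u⇒meets-e : ∀ W → W meets ⁅ u ⁆ ≡ true → W meets e ≡ true
    ∋u⇒meets-e W W∋u = meets-at W e u (trans (sym (meets-⁅⁆ W u)) W∋u) u∈e

  covers-contract-∌ : ∀ W → W meets ⁅ u ⁆ ≡ false → covers C W ≡ covers H W
  covers-contract-∌ W W∌u with W meets e in W∩e
  ... | true  = trans (cong (_∧ all (_meets W) (edges C)) (trans verts∌u (⊆ᵇ-verts-─ G W e W∩e)))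
                      (sym (covers-hideSet-meets (delEdge G i) W e W∩e))
    where
    verts∌u : W ⊆ᵇ verts C ≡ W ⊆ᵇ (verts G ─ e)
    verts∌u = ⊆ᵇ-∪-disjoint W (verts G ─ e) ⁅ u ⁆ W∌u
  ... | false = cong₂ _∧_ (⊆ᵇ-∪-disjoint W (verts G ─ e) ⁅ u ⁆ W∌u)
    (trans (all-map (_meets W) merge E′) (trans (all-cong edge E′) (sym (all-map (_meets W) (_─ e) E′))))
    where
    edge : ∀ f → merge f meets W ≡ (f ─ e) meets W
    edge f with avoids e f
    ... | true  = sym (─-meets f W e W∩e)
    ... | false = trans (meets-∪ˡ (f ─ e) ⁅ u ⁆ W)
                        (trans (cong ((f ─ e) meets W ∨_) (trans (⁅⁆-meets u W) (trans (sym (meets-⁅⁆ W u)) W∌u)))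
                               (∨-identityʳ _))

  covers-contract-∋ : ∀ W → W meets ⁅ u ⁆ ≡ false → covers C (W ∪ ⁅ u ⁆) ≡ covers (delSet G e) W
  covers-contract-∋ W W∌u = cong₂ _∧_ verts∋u
    (trans (all-map (_meets (W ∪ ⁅ u ⁆)) merge E′) (trans (all-cong edge E′) (sym edges∋u)))
    where
    verts∋u : (W ∪ ⁅ u ⁆) ⊆ᵇ verts C ≡ W ⊆ᵇ (verts G ─ e)
    verts∋u = trans (∪-⊆ᵇ W ⁅ u ⁆ (verts C)) (trans (cong₂ _∧_ (⊆ᵇ-∪-disjoint W (verts G ─ e) ⁅ u ⁆ W∌u)
                    (trans (⁅⁆-⊆ᵇ u (verts C)) (∪⁅⁆-∋ (verts G ─ e) u))) (∧-identityʳ _))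
    P : Subset n → Bool
    P f = not (avoids e f) ∨ f meets W
    edges∋u : all (_meets W) (edges (delSet G e)) ≡ all P E′
    edges∋u = trans (all-filter (_meets W) (avoids e) (edges G)) (trans (all-removeAt P (edges G) i) (cong (_∧ all P E′) Pe))
      where
      Pe : P e ≡ true
      Pe = cong (_∨ e meets W) (trans (cong not (avoids≡not-meets e e)) (trans (not-involutive _) (meets-at e e u u∈e u∈e)))
    edge : ∀ f → merge f meets (W ∪ ⁅ u ⁆) ≡ P f
    edge f with avoids e f in f∩e≡∅
    ... | true  = trans (meets-∪ʳ f W ⁅ u ⁆) (trans (cong (f meets W ∨_) (trans (meets-⁅⁆ f u) u∉f)) (∨-identityʳ _))
      where
      u∉f : vlookup f u ≡ false
      u∉f = disjoint-lookup f e u (avoids⇒disjoint e f f∩e≡∅) u∈e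
    ... | false = trans (meets-∪ˡ (f ─ e) ⁅ u ⁆ (W ∪ ⁅ u ⁆))
                        (trans (cong ((f ─ e) meets (W ∪ ⁅ u ⁆) ∨_) (trans (⁅⁆-meets u (W ∪ ⁅ u ⁆)) (∪⁅⁆-∋ W u)))
                               (∨-zeroʳ _))

  Ψ-contract : (x : ℤ) → Ψ C x ≡ x * Ψ (delSet G e) x + Ψ H x
  Ψ-contract x = begin
    Ψ C x
      ≡⟨ Ψ≡∑coverWeight C x ⟩
    ∑ₛ n (coverWeight C x)
      ≡⟨ ∑ₛ-split-at n u (coverWeight C x) ⟩
    ∑ₛ n (λ W → [ not (W meets ⁅ u ⁆) ]* coverWeight C x (W ∪ ⁅ u ⁆))
      + ∑ₛ n (λ W → [ not (W meets ⁅ u ⁆) ]* coverWeight C x W)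
      ≡⟨ cong₂ _+_ (sumOver-cong (allSubsets n) containing) (sumOver-cong (allSubsets n) avoiding) ⟩
    ∑ₛ n (λ W → x * coverWeight (delSet G e) x W) + ∑ₛ n (coverWeight H x)
      ≡⟨ cong₂ _+_ (trans (sumOver-* (allSubsets n) x _) (cong (x *_) (sym (Ψ≡∑coverWeight (delSet G e) x))))
                   (sym (Ψ≡∑coverWeight H x)) ⟩
    x * Ψ (delSet G e) x + Ψ H x ∎
    where
    open ≡-Reasoning
    containing : ∀ W → [ not (W meets ⁅ u ⁆) ]* coverWeight C x (W ∪ ⁅ u ⁆) ≡ x * coverWeight (delSet G e) x W
    containing W with W meets ⁅ u ⁆ in W∩u
    ... | true  = sym (trans (cong (λ b → x * [ b ]* (x ^ ∣ W ∣)) (covers-delSet-meets G W e (∋u⇒meets-e W W∩u)))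
                             (ℤP.*-zeroʳ x))
    ... | false = trans (cong₂ (λ b k → [ b ]* (x ^ k)) (covers-contract-∋ W W∩u) ∣W∪u∣)
                        (sym (*-[]* x (covers (delSet G e) W) (x ^ ∣ W ∣)))
      where
      ∣W∪u∣ : ∣ W ∪ ⁅ u ⁆ ∣ ≡ suc ∣ W ∣
      ∣W∪u∣ = trans (∣∪∣-disjoint W ⁅ u ⁆ W∩u)
                    (trans (cong (∣ W ∣ +ℕ_) (∣⁅x⁆∣≡1 u)) (ℕP.+-comm ∣ W ∣ 1))
    avoiding : ∀ W → [ not (W meets ⁅ u ⁆) ]* coverWeight C x W ≡ coverWeight H x W
    avoiding W with W meets ⁅ u ⁆ in W∩u
    ... | true  = sym (cong (λ b → [ b ]* (x ^ ∣ W ∣)) (covers-hideSet-meets (delEdge G i) W e (∋u⇒meets-e W W∩u)))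
    ... | false = cong (λ b → [ b ]* (x ^ ∣ W ∣)) (covers-contract-∌ W W∩u)

-- The recurrences

Ψ-deleteVertex : ∀ {n} (G : Hypergraph n) (v : Fin n) → v ∈ verts G → (x : ℤ) →
                 Ψ G x ≡ x * Ψ (delV G v) x + Ψ (hideV G v) x
Ψ-deleteVertex {n} G v v∈V x = begin
  Ψ G x
    ≡⟨ Ψ≡∑coverWeight G x ⟩
  ∑ₛ n (coverWeight G x)
    ≡⟨ ∑ₛ-split-at n v (coverWeight G x) ⟩
  ∑ₛ n (λ W → [ not (W meets ⁅ v ⁆) ]* coverWeight G x (W ∪ ⁅ v ⁆))
    + ∑ₛ n (λ W → [ not (W meets ⁅ v ⁆) ]* coverWeight G x W)
    ≡⟨ cong₂ _+_ (∑ₛ-translate n ⁅ v ⁆ (coverWeight G x)) (sym (Ψ-hideSet≡∑avoiding G ⁅ v ⁆ x)) ⟩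
  ∑ₛ n (λ W → [ ⁅ v ⁆ ⊆ᵇ W ]* coverWeight G x W) + Ψ (hideV G v) x
    ≡⟨ cong (_+ Ψ (hideV G v) x)
            (Ψ-delSet≡∑containing G ⁅ v ⁆ (trans (⁅⁆-⊆ᵇ v (verts G)) ([]=⇒lookup v∈V)) x) ⟨
  x ^ ∣ ⁅ v ⁆ ∣ * Ψ (delV G v) x + Ψ (hideV G v) x
    ≡⟨ cong (λ k → x ^ k * Ψ (delV G v) x + Ψ (hideV G v) x) (∣⁅x⁆∣≡1 v) ⟩
  x ^ 1 * Ψ (delV G v) x + Ψ (hideV G v) x
    ≡⟨ cong (λ y → y * Ψ (delV G v) x + Ψ (hideV G v) x) (ℤP.^-identityʳ x) ⟩
  x * Ψ (delV G v) x + Ψ (hideV G v) x ∎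
  where open ≡-Reasoning

-- Hiding S empties the edge S, which no set can meet.
Ψ-hideEdge : ∀ {n} (G : Hypergraph n) (S : Subset n) → S ∈ₗ edges G → (x : ℤ) → Ψ (hideSet G S) x ≡ 0ℤ
Ψ-hideEdge {n} G S S∈E x =
  trans (Ψ≡∑coverWeight (hideSet G S) x) (trans (sumOver-cong (allSubsets n) uncovered) (sumOver-0 (allSubsets n)))
  where
  uncovered : ∀ W → coverWeight (hideSet G S) x W ≡ 0ℤ
  uncovered W = cong (λ b → [ b ]* (x ^ ∣ W ∣)) (trans (cong (W ⊆ᵇ (verts G ─ S) ∧_)
    (trans (all-map (_meets W) (_─ S) (edges G)) (all-false (λ f → (f ─ S) meets W) (edges G) S∈E (─-self-meets S W))))
    (∧-zeroʳ _))

Ψ-deleteLoopVertex : ∀ {n} (G : Hypergraph n) (v : Fin n) → v ∈ verts G → ⁅ v ⁆ ∈ₗ edges G → (x : ℤ) →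
                     Ψ G x ≡ x * Ψ (delV G v) x
Ψ-deleteLoopVertex G v v∈V ⁅v⁆∈E x = trans (Ψ-deleteVertex G v v∈V x)
  (trans (cong (x * Ψ (delV G v) x +_) (Ψ-hideEdge G ⁅ v ⁆ ⁅v⁆∈E x)) (ℤP.+-identityʳ _))

m≡m+n-n : ∀ m n → m ≡ m + n - n
m≡m+n-n = solve-∀

Ψ-deleteEdge : ∀ {n} (G : Hypergraph n) (i : Fin (length (edges G))) (x : ℤ) →
               Ψ G x ≡ Ψ (delEdge G i) x - Ψ (hideSet (delEdge G i) (lookup (edges G) i)) x
Ψ-deleteEdge {n} G i x = trans (m≡m+n-n (Ψ G x) (Ψ H x)) (cong (_- Ψ H x) (sym Ψ[G-e]))
  where
  open ≡-Reasoning
  e : Subset n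
  e = lookup (edges G) i
  H : Hypergraph n
  H = hideSet (delEdge G i) e
  meeting : ∀ W → [ W meets e ]* coverWeight (delEdge G i) x W ≡ coverWeight G x W
  meeting W = trans ([]*-∧ (W meets e) _ (x ^ ∣ W ∣)) (cong (λ b → [ b ]* (x ^ ∣ W ∣))
    (sym (trans (covers-delEdge G W i) (cong (_∧ covers (delEdge G i) W) (meets-comm e W)))))
  Ψ[G-e] : Ψ (delEdge G i) x ≡ Ψ G x + Ψ H x
  Ψ[G-e] = begin
    Ψ (delEdge G i) x
      ≡⟨ Ψ≡∑coverWeight (delEdge G i) x ⟩
    ∑ₛ n (coverWeight (delEdge G i) x)
      ≡⟨ ∑ₛ-split n (_meets e) _ ⟩
    ∑ₛ n (λ W → [ W meets e ]* coverWeight (delEdge G i) x W)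
      + ∑ₛ n (λ W → [ not (W meets e) ]* coverWeight (delEdge G i) x W)
      ≡⟨ cong₂ _+_ (trans (sumOver-cong (allSubsets n) meeting) (sym (Ψ≡∑coverWeight G x)))
                   (sym (Ψ-hideSet≡∑avoiding (delEdge G i) e x)) ⟩
    Ψ G x + Ψ H x ∎

Ψ-deleteRedundantEdge : ∀ {n} (G : Hypergraph n) (i j : Fin (length (edges G))) → j ≢ i →
                        lookup (edges G) j ⊆ lookup (edges G) i → (x : ℤ) → Ψ G x ≡ Ψ (delEdge G i) x
Ψ-deleteRedundantEdge {n} G i j j≢i eⱼ⊆eᵢ x = begin
  Ψ G x
    ≡⟨ Ψ≡∑coverWeight G x ⟩
  ∑ₛ n (coverWeight G x)
    ≡⟨ sumOver-cong (allSubsets n) (λ W → cong (λ b → [ b ]* (x ^ ∣ W ∣)) (sameCovers W)) ⟩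
  ∑ₛ n (coverWeight (delEdge G i) x)
    ≡⟨ Ψ≡∑coverWeight (delEdge G i) x ⟨
  Ψ (delEdge G i) x ∎
  where
  open ≡-Reasoning
  E : List (Subset n)
  E = edges G
  eⱼ⊆ᵇeᵢ : lookup E j ⊆ᵇ lookup E i ≡ true
  eⱼ⊆ᵇeᵢ = trans (sym (does-⊆? (lookup E j) (lookup E i))) (dec-true (lookup E j ⊆? lookup E i) eⱼ⊆eᵢ)
  absorb : ∀ a b → (b ≡ true → a ≡ true) → a ∧ b ≡ b
  absorb a false _ = ∧-zeroʳ a
  absorb a true  h = trans (∧-identityʳ a) (h refl)
  meetsᵢ : ∀ W → covers (delEdge G i) W ≡ true → lookup E i meets W ≡ true
  meetsᵢ W covered = ⊆ᵇ-meets (lookup E j) (lookup E i) W eⱼ⊆ᵇeᵢ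
    (all-removeAt-lookup (_meets W) E i j (∧-elimʳ (W ⊆ᵇ verts G) _ covered) j≢i)
  sameCovers : ∀ W → covers G W ≡ covers (delEdge G i) W
  sameCovers W = trans (covers-delEdge G W i) (absorb _ (covers (delEdge G i) W) (meetsᵢ W))

Ψ-deleteNonMinimalEdge : ∀ {n} (G : Hypergraph n) (i : Fin (length (edges G))) (x : ℤ) →
  ¬ (∀ (j : Fin (length (edges G))) → j ≢ i → ¬ (lookup (edges G) j ⊆ lookup (edges G) i)) →
  Ψ G x ≡ Ψ (delEdge G i) x
Ψ-deleteNonMinimalEdge G i x notMinimal = decidable-stable (Ψ G x ℤP.≟ Ψ (delEdge G i) x)
  (λ Ψ≢ → notMinimal (λ j j≢i eⱼ⊆eᵢ → Ψ≢ (Ψ-deleteRedundantEdge G i j j≢i eⱼ⊆eᵢ x)))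

signedΨ-delSet≡∑containing : ∀ {n} (G : Hypergraph n) (B : Subset n) → B ⊆ᵇ verts G ≡ true → (x : ℤ) →
  - ((- x) ^ ∣ B ∣) * Ψ (delSet G B) x ≡ ∑ₛ n (λ W → [ B ⊆ᵇ W ]* (coverWeight G x W * - sign ∣ B ∣))
signedΨ-delSet≡∑containing {n} G B B⊆V x = begin
  - ((- x) ^ ∣ B ∣) * Ψ (delSet G B) x
    ≡⟨ cong (λ p → - p * Ψ (delSet G B) x) (-x^≡sign*x^ x ∣ B ∣) ⟩
  - (sign ∣ B ∣ * x ^ ∣ B ∣) * Ψ (delSet G B) x
    ≡⟨ reassoc (sign ∣ B ∣) (x ^ ∣ B ∣) (Ψ (delSet G B) x) ⟩
  - sign ∣ B ∣ * (x ^ ∣ B ∣ * Ψ (delSet G B) x)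
    ≡⟨ cong (- sign ∣ B ∣ *_) (Ψ-delSet≡∑containing G B B⊆V x) ⟩
  - sign ∣ B ∣ * ∑ₛ n (λ W → [ B ⊆ᵇ W ]* coverWeight G x W)
    ≡⟨ sumOver-* (allSubsets n) (- sign ∣ B ∣) _ ⟨
  ∑ₛ n (λ W → - sign ∣ B ∣ * [ B ⊆ᵇ W ]* coverWeight G x W)
    ≡⟨ sumOver-cong (allSubsets n) (λ W → trans (*-[]* (- sign ∣ B ∣) (B ⊆ᵇ W) (coverWeight G x W))
                                              (cong ([ B ⊆ᵇ W ]*_) (ℤP.*-comm (- sign ∣ B ∣) (coverWeight G x W)))) ⟩
  ∑ₛ n (λ W → [ B ⊆ᵇ W ]* (coverWeight G x W * - sign ∣ B ∣)) ∎
  where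
  open ≡-Reasoning
  reassoc : ∀ s p q → - (s * p) * q ≡ - s * (p * q)
  reassoc = solve-∀

coverWeight-*-meets : ∀ {n} (G : Hypergraph n) (i : Fin (length (edges G))) (x : ℤ) (W : Subset n) →
                      coverWeight G x W * [ lookup (edges G) i meets W ]* 1ℤ ≡ coverWeight G x W
coverWeight-*-meets G i x W with covers G W in covered
... | false = refl
... | true  = trans (cong (λ b → x ^ ∣ W ∣ * [ b ]* 1ℤ) e∩W) (ℤP.*-identityʳ (x ^ ∣ W ∣))
  where
  e∩W : lookup (edges G) i meets W ≡ true
  e∩W = ∧-elimˡ (lookup (edges G) i meets W) _ (trans (sym (covers-delEdge G W i)) covered)

Ψ-inclusionExclusion : ∀ {n} (G : Hypergraph n) (i : Fin (length (edges G))) →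
                       lookup (edges G) i ⊆ verts G → (x : ℤ) →
                       Ψ G x ≡ sumℤ (map (λ B → - ((- x) ^ ∣ B ∣) * Ψ (delSet G B) x)
                                         (nonemptySubsetsOf (lookup (edges G) i)))
Ψ-inclusionExclusion {n} G i e⊆V x = sym (begin
  sumOver (nonemptySubsetsOf e) term
    ≡⟨ sumOver-filter (allSubsets n) (λ B → does (B ⊆? e) ∧ does (nonempty? B)) term ⟩
  ∑ₛ n (λ B → [ does (B ⊆? e) ∧ does (nonempty? B) ]* term B)
    ≡⟨ sumOver-cong (allSubsets n) (λ B → cong (λ b → [ b ]* term B) (cong₂ _∧_ (does-⊆? B e) (does-nonempty? B))) ⟩
  ∑ₛ n (λ B → [ B ⊆ᵇ e ∧ nonemptyᵇ B ]* term B)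
    ≡⟨ sumOver-cong (allSubsets n) expand ⟩
  ∑ₛ n (λ B → ∑ₛ n (λ W → [ B ⊆ᵇ (e ∩ W) ∧ nonemptyᵇ B ]* (coverWeight G x W * - sign ∣ B ∣)))
    ≡⟨ sumOver-swap (allSubsets n) (allSubsets n) _ ⟩
  ∑ₛ n (λ W → ∑ₛ n (λ B → [ B ⊆ᵇ (e ∩ W) ∧ nonemptyᵇ B ]* (coverWeight G x W * - sign ∣ B ∣)))
    ≡⟨ sumOver-cong (allSubsets n) collapse ⟩
  ∑ₛ n (coverWeight G x)
    ≡⟨ Ψ≡∑coverWeight G x ⟨
  Ψ G x ∎)
  where
  open ≡-Reasoning
  e : Subset n
  e = lookup (edges G) i
  e⊆ᵇV : e ⊆ᵇ verts G ≡ true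
  e⊆ᵇV = trans (sym (does-⊆? e (verts G))) (dec-true (e ⊆? verts G) e⊆V)
  term : Subset n → ℤ
  term B = - ((- x) ^ ∣ B ∣) * Ψ (delSet G B) x
  expand : ∀ B → [ B ⊆ᵇ e ∧ nonemptyᵇ B ]* term B
               ≡ ∑ₛ n (λ W → [ B ⊆ᵇ (e ∩ W) ∧ nonemptyᵇ B ]* (coverWeight G x W * - sign ∣ B ∣))
  expand B = trans ([]*-congᵗ (B ⊆ᵇ e ∧ nonemptyᵇ B) (λ B⊆e∧B≢∅ → signedΨ-delSet≡∑containing G B
                     (⊆ᵇ-trans B e (verts G) (∧-elimˡ (B ⊆ᵇ e) _ B⊆e∧B≢∅) e⊆ᵇV) x))
                   (sym gather)
    where
    gather : ∑ₛ n (λ W → [ B ⊆ᵇ (e ∩ W) ∧ nonemptyᵇ B ]* (coverWeight G x W * - sign ∣ B ∣))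
           ≡ [ B ⊆ᵇ e ∧ nonemptyᵇ B ]* ∑ₛ n (λ W → [ B ⊆ᵇ W ]* (coverWeight G x W * - sign ∣ B ∣))
    gather = trans (sumOver-cong (allSubsets n) (λ W → trans
        (cong (λ b → [ b ]* (coverWeight G x W * - sign ∣ B ∣))
              (trans (cong (_∧ nonemptyᵇ B) (⊆ᵇ-∩ B e W)) (∧-rightSwap (B ⊆ᵇ e) (B ⊆ᵇ W) (nonemptyᵇ B))))
        (sym ([]*-∧ (B ⊆ᵇ e ∧ nonemptyᵇ B) (B ⊆ᵇ W) _))))
      ([]*-∑ₛ n (B ⊆ᵇ e ∧ nonemptyᵇ B) _)
  collapse : ∀ W → ∑ₛ n (λ B → [ B ⊆ᵇ (e ∩ W) ∧ nonemptyᵇ B ]* (coverWeight G x W * - sign ∣ B ∣))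
                 ≡ coverWeight G x W
  collapse W = begin
    ∑ₛ n (λ B → [ B ⊆ᵇ (e ∩ W) ∧ nonemptyᵇ B ]* (coverWeight G x W * - sign ∣ B ∣))
      ≡⟨ sumOver-cong (allSubsets n) (λ B → sym (*-[]* (coverWeight G x W) _ (- sign ∣ B ∣))) ⟩
    ∑ₛ n (λ B → coverWeight G x W * [ B ⊆ᵇ (e ∩ W) ∧ nonemptyᵇ B ]* (- sign ∣ B ∣))
      ≡⟨ sumOver-* (allSubsets n) (coverWeight G x W) _ ⟩
    coverWeight G x W * ∑ₛ n (λ B → [ B ⊆ᵇ (e ∩ W) ∧ nonemptyᵇ B ]* (- sign ∣ B ∣))
      ≡⟨ cong (coverWeight G x W *_) (∑ₛ-sign-nonempty n (e ∩ W)) ⟩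
    coverWeight G x W * [ e meets W ]* 1ℤ
      ≡⟨ coverWeight-*-meets G i x W ⟩
    coverWeight G x W ∎

Ψ-contractEdge : ∀ {n} (G : Hypergraph n) (i : Fin (length (edges G))) (u : Fin n) → u ∈ lookup (edges G) i →
                 (x : ℤ) → Ψ G x ≡ Ψ (delEdge G i) x - Ψ (contractVia G i u) x + x * Ψ (delSet G (lookup (edges G) i)) x
Ψ-contractEdge G i u u∈e x rewrite Contraction.Ψ-contract G i u u∈e x | Ψ-deleteEdge G i x =
  rearrange (Ψ (delEdge G i) x) (x * Ψ (delSet G (lookup (edges G) i)) x) (Ψ (hideSet (delEdge G i) (lookup (edges G) i)) x)
  where
  rearrange : ∀ d a h → d - h ≡ d - (a + h) + a
  rearrange = solve-∀

mainTheorem14 : ∀ {n : ℕ} (G : Hypergraph n) → WellFormed G →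
    (v : Fin n) → v ∈ verts G →
    (i : Fin (length (edges G))) →
    (x : ℤ) →
      ((⁅ v ⁆ ∉ₗ edges G → Ψ G x ≡ x * Ψ (delV G v) x + Ψ (hideV G v) x)
       × (⁅ v ⁆ ∈ₗ edges G → Ψ G x ≡ x * Ψ (delV G v) x))
      × (((∀ (j : Fin (length (edges G))) → j ≢ i → ¬ (lookup (edges G) j ⊆ lookup (edges G) i)) →
            Ψ G x ≡ Ψ (delEdge G i) x - Ψ (hideSet (delEdge G i) (lookup (edges G) i)) x)
         × (¬ (∀ (j : Fin (length (edges G))) → j ≢ i → ¬ (lookup (edges G) j ⊆ lookup (edges G) i)) →
            Ψ G x ≡ Ψ (delEdge G i) x))
      × (Ψ G x ≡ sumℤ (map (λ B → - ((- x) ^ ∣ B ∣) * Ψ (delSet G B) x)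
                            (nonemptySubsetsOf (lookup (edges G) i))))
      × (∀ (u : Fin n) → u ∈ lookup (edges G) i →
           Ψ G x ≡ Ψ (delEdge G i) x - Ψ (contractVia G i u) x + x * Ψ (delSet G (lookup (edges G) i)) x)
mainTheorem14 G (_ , edges⊆V) v v∈V i x =
  ( (λ _ → Ψ-deleteVertex G v v∈V x)
  , (λ ⁅v⁆∈E → Ψ-deleteLoopVertex G v v∈V ⁅v⁆∈E x) )
  , ( (λ _ → Ψ-deleteEdge G i x) , Ψ-deleteNonMinimalEdge G i x )
  , Ψ-inclusionExclusion G i (All.lookup edges⊆V (∈-lookup i)) x
  , (λ u u∈e → Ψ-contractEdge G i u u∈e x)
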